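{- Let $K_{m,n}$ be the complete bipartite graph with vertex parts $U$ ($|U|=m$) and $V$ ($|V|=n$), and suppose $b_U$ vertices of $U$ and $b_V$ vertices of $V$ are blue, the rest white. Then the probability that, in one application of the probabilistic forcing phase, the blue vertices of $U$ force every white vertex of $V$ blue is \[\mathbf{P}[U\to V]=\left(1-\left(1-\frac{b_V+1}{|V|}\right)^{b_U}\right)^{|V|-b_V}.\]
   Context: Forcing phase: with $B$ the set of blue vertices, each blue vertex $u$ independently attempts to force (color blue) each white neighbor $w$, succeeding with probability $|N[u]\cap B|/\deg u$, where $N[u]$ is the closed neighborhood of $u$; a white vertex becomes blue if at least one attempt on it succeeds. $0^0=1$. -}

module Defs where

open import Data.Bool using (Bool; true; false; _∧_; _∨_; not; if_then_else_)
open import Data.Nat using (ℕ; zero; suc) renaming (_+_ to _+ℕ_; _*_ to _*ℕ_)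
open import Data.Fin using (Fin; zero; suc; _↑ˡ_; _↑ʳ_; combine; remQuot)
open import Data.Fin.Properties using (_≟_)
open import Data.Integer using (+_)
open import Data.Rational using (ℚ; 0ℚ; 1ℚ; _+_; _-_; _*_; _/_)
open import Data.Product using (_,_)
open import Data.Vec.Functional using (_∷_)
open import Relation.Nullary.Decidable using (⌊_⌋)

count : ∀ {k} → (Fin k → Bool) → ℕ
count {zero}  P = 0
count {suc k} P = (if P zero then 1 else 0) +ℕ count (λ i → P (suc i))

allF : ∀ {k} → (Fin k → Bool) → Bool
allF {zero}  P = true
allF {suc k} P = P zero ∧ allF (λ i → P (suc i))

anyF : ∀ {k} → (Fin k → Bool) → Bool
anyF {zero}  P = false
anyF {suc k} P = P zero ∨ anyF (λ i → P (suc i))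

_^ℚ_ : ℚ → ℕ → ℚ
x ^ℚ zero  = 1ℚ
x ^ℚ suc n = x * (x ^ℚ n)

-- a / d as a rational, with the convention a / 0 = 0 (only used when irrelevant)
_÷ℕ_ : ℕ → ℕ → ℚ
a ÷ℕ zero  = 0ℚ
a ÷ℕ suc d = (+ a) / suc d

-- Probability of an event E under k independent Bernoulli trials,
-- trial i succeeding (= true) with probability q i.
prob : (k : ℕ) → (Fin k → ℚ) → ((Fin k → Bool) → Bool) → ℚ
prob zero    q E = if E (λ ()) then 1ℚ else 0ℚ
prob (suc k) q E =
  q zero * prob k (λ i → q (suc i)) (λ ω → E (true ∷ ω))
  + (1ℚ - q zero) * prob k (λ i → q (suc i)) (λ ω → E (false ∷ ω))

Graph : ℕ → Set
Graph N = Fin N → Fin N → Bool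

degree : ∀ {N} → Graph N → Fin N → ℕ
degree G u = count (G u)

closedNbhdBlue : ∀ {N} → Graph N → (Fin N → Bool) → Fin N → ℕ
closedNbhdBlue G B u = count (λ v → (⌊ v ≟ u ⌋ ∨ G u v) ∧ B v)

forceProb : ∀ {N} → Graph N → (Fin N → Bool) → Fin N → ℚ
forceProb G B u = closedNbhdBlue G B u ÷ℕ degree G u

-- Outcome of a forcing phase: one coin per ordered pair (u , w), encoded as
-- an index in Fin (N * N) via combine / remQuot.  The coin for (u , w) is a
-- genuine forcing attempt iff u is blue, w is white and u ~ w; it then
-- succeeds with probability forceProb G B u.  Other coins have probability 0
-- and are never inspected by the events considered.
attemptProb : ∀ {N} → Graph N → (Fin N → Bool) → Fin (N *ℕ N) → ℚ
attemptProb {N} G B i with remQuot {N} N i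
... | (u , w) = if B u ∧ not (B w) ∧ G u w then forceProb G B u else 0ℚ

attempt : ∀ {N} → (Fin (N *ℕ N) → Bool) → Fin N → Fin N → Bool
attempt {N} ω u w = ω (combine {N} {N} u w)

-- Complete bipartite graph K_{m,n}: vertices Fin (m + n);
-- U = {u ↑ˡ n}, V = {m ↑ʳ v}.

inU : ∀ {m n} → Fin (m +ℕ n) → Bool
inU {zero}  {n} x       = false
inU {suc m} {n} zero    = true
inU {suc m} {n} (suc x) = inU {m} {n} x

K : (m n : ℕ) → Graph (m +ℕ n)
K m n x y = not (inU {m} {n} x ∧ inU {m} {n} y) ∧ (inU {m} {n} x ∨ inU {m} {n} y)

blueU : ∀ m n → (Fin (m +ℕ n) → Bool) → ℕ
blueU m n B = count (λ (u : Fin m) → B (u ↑ˡ n))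

blueV : ∀ m n → (Fin (m +ℕ n) → Bool) → ℕ
blueV m n B = count (λ (v : Fin n) → B (m ↑ʳ v))

UforcesV : ∀ m n → (Fin (m +ℕ n) → Bool) → (Fin ((m +ℕ n) *ℕ (m +ℕ n)) → Bool) → Bool
UforcesV m n B ω =
  allF (λ (v : Fin n) →
    if B (m ↑ʳ v) then true
    else anyF (λ (u : Fin m) → B (u ↑ˡ n) ∧ attempt ω (u ↑ˡ n) (m ↑ʳ v)))

P[U→V] : ∀ m n → (Fin (m +ℕ n) → Bool) → ℚ
P[U→V] m n B =
  prob ((m +ℕ n) *ℕ (m +ℕ n)) (attemptProb (K m n) B) (UforcesV m n B)

-- In K_{m,n} a blue vertex u of U has degree |V| and closed neighbourhood
-- {u} ∪ V, so it forces each white neighbour with probability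
-- p = (b_V + 1)/|V|.  A white vertex v of V stays white iff all b_U attempts
-- on it fail, which has probability (1 - p)^{b_U}.  The events "v is forced"
-- for distinct v read disjoint sets of coins, so they are independent and
-- the probability of [U → V] is the product over the |V| - b_V white v.
module Submission where

open import Defs
open import Data.Bool using (Bool; true; false; _∧_; _∨_; not; if_then_else_)
open import Data.Bool.Properties using (∨-identityʳ; ∨-zeroʳ)
open import Data.Nat using (ℕ; zero; suc; _∸_; _≤_; z≤n; s≤s) renaming (_+_ to _+ℕ_; _*_ to _*ℕ_)
open import Data.Nat.Properties using (m≤n⇒m≤1+n; +-∸-assoc; +-assoc; +-identityʳ)
open import Data.Fin using (Fin; zero; suc; _↑ˡ_; _↑ʳ_; combine; remQuot)
open import Data.Fin.Properties using (_≟_; 0≢1+n; suc-injective; ↑ˡ-injective; ↑ʳ-injective; remQuot-combine)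
open import Data.Rational using (ℚ; 0ℚ; 1ℚ; _+_; _-_; _*_)
open import Data.Rational.Properties using (*-identityˡ)
open import Data.Rational.Solver using (module +-*-Solver)
open import Data.Product using (proj₁; proj₂)
open import Data.Sum using (_⊎_; inj₁; inj₂)
open import Data.Empty using (⊥-elim)
open import Data.Vec.Functional using (_∷_)
open import Function using (_∘_; Injective)
open import Relation.Binary.PropositionalEquality
open import Relation.Nullary using (yes; no)
open import Relation.Nullary.Decidable using (⌊_⌋; dec-true; isYes≗does; ⌊⌋-map′)

open +-*-Solver

Outcome : ℕ → Set
Outcome k = Fin k → Bool

Event : ℕ → Set
Event k = Outcome k → Bool

-- prob (suc k) q E unfolds definitionally to mix (q zero) applied to the two conditional probabilities.
mix : ℚ → ℚ → ℚ → ℚ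
mix q a b = q * a + (1ℚ - q) * b

mix-same : ∀ q a → mix q a a ≡ a
mix-same = solve 2 (λ q a → q :* a :+ (con 1ℚ :- q) :* a := a) refl

mix-complement : ∀ q a b → mix q (1ℚ - a) (1ℚ - b) ≡ 1ℚ - mix q a b
mix-complement = solve 3 (λ q a b →
  q :* (con 1ℚ :- a) :+ (con 1ℚ :- q) :* (con 1ℚ :- b) := con 1ℚ :- (q :* a :+ (con 1ℚ :- q) :* b)) refl

mix-indicator : ∀ q → mix q 1ℚ 0ℚ ≡ q
mix-indicator = solve 1 (λ q → q :* con 1ℚ :+ (con 1ℚ :- q) :* con 0ℚ := q) refl

mix-* : ∀ q {a₁ a₂ b₁ b₂} → a₁ ≡ a₂ ⊎ b₁ ≡ b₂ → mix q (a₁ * b₁) (a₂ * b₂) ≡ mix q a₁ a₂ * mix q b₁ b₂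
mix-* q {a} {_} {b₁} {b₂} (inj₁ refl) = solve 4 (λ q a b₁ b₂ →
  q :* (a :* b₁) :+ (con 1ℚ :- q) :* (a :* b₂)
    := (q :* a :+ (con 1ℚ :- q) :* a) :* (q :* b₁ :+ (con 1ℚ :- q) :* b₂)) refl q a b₁ b₂
mix-* q {a₁} {a₂} {b} {_} (inj₂ refl) = solve 4 (λ q a₁ a₂ b →
  q :* (a₁ :* b) :+ (con 1ℚ :- q) :* (a₂ :* b)
    := (q :* a₁ :+ (con 1ℚ :- q) :* a₂) :* (q :* b :+ (con 1ℚ :- q) :* b)) refl q a₁ a₂ b

prob-cong : ∀ k q {E E′ : Event k} → (∀ ω → E ω ≡ E′ ω) → prob k q E ≡ prob k q E′
prob-cong zero    q E≗E′ = cong (λ b → if b then 1ℚ else 0ℚ) (E≗E′ (λ ()))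
prob-cong (suc k) q E≗E′ = cong₂ (mix (q zero))
  (prob-cong k (q ∘ suc) (λ ω → E≗E′ (true ∷ ω)))
  (prob-cong k (q ∘ suc) (λ ω → E≗E′ (false ∷ ω)))

prob-const : ∀ k q b → prob k q (λ _ → b) ≡ (if b then 1ℚ else 0ℚ)
prob-const zero    q b = refl
prob-const (suc k) q b = trans
  (cong₂ (mix (q zero)) (prob-const k (q ∘ suc) b) (prob-const k (q ∘ suc) b))
  (mix-same (q zero) _)

prob-not : ∀ k q (E : Event k) → prob k q (not ∘ E) ≡ 1ℚ - prob k q E
prob-not zero q E = indicator-not (E (λ ()))
  where
  indicator-not : ∀ b → (if not b then 1ℚ else 0ℚ) ≡ 1ℚ - (if b then 1ℚ else 0ℚ)
  indicator-not true  = refl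
  indicator-not false = refl
prob-not (suc k) q E = trans
  (cong₂ (mix (q zero)) (prob-not k (q ∘ suc) _) (prob-not k (q ∘ suc) _))
  (mix-complement (q zero) _ _)

prob-coordinate : ∀ k q (i : Fin k) → prob k q (λ ω → ω i) ≡ q i
prob-coordinate (suc k) q zero = trans
  (cong₂ (mix (q zero)) (prob-const k (q ∘ suc) true) (prob-const k (q ∘ suc) false))
  (mix-indicator (q zero))
prob-coordinate (suc k) q (suc i) = trans
  (cong₂ (mix (q zero)) (prob-coordinate k (q ∘ suc) i) (prob-coordinate k (q ∘ suc) i))
  (mix-same (q zero) (q (suc i)))

DependsOn : ∀ {k} → (Fin k → Bool) → Event k → Set
DependsOn S E = ∀ ω ω′ → (∀ i → S i ≡ true → ω i ≡ ω′ i) → E ω ≡ E ω′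

DependsOn-tail : ∀ {k} {S : Fin (suc k) → Bool} {E} b → DependsOn S E → DependsOn (S ∘ suc) (λ ω → E (b ∷ ω))
DependsOn-tail b dep ω ω′ agree = dep (b ∷ ω) (b ∷ ω′) λ { zero _ → refl ; (suc i) → agree i }

DependsOn-head : ∀ {k} {S : Fin (suc k) → Bool} {E} → DependsOn S E → S zero ≡ false →
  ∀ ω → E (true ∷ ω) ≡ E (false ∷ ω)
DependsOn-head dep S₀≡false ω = dep _ _ λ
  { zero S₀≡true → ⊥-elim (false≢true (trans (sym S₀≡false) S₀≡true))
  ; (suc i) _ → refl }
  where
  false≢true : false ≢ true
  false≢true ()

DependsOn-coordinate : ∀ {k} {S : Fin k → Bool} i (f : Bool → Bool) → S i ≡ true → DependsOn S (λ ω → f (ω i))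
DependsOn-coordinate i f Sᵢ ω ω′ agree = cong f (agree i Sᵢ)

prob-∧ : ∀ k q (S : Fin k → Bool) {E₁ E₂ : Event k} → DependsOn S E₁ → DependsOn (not ∘ S) E₂ →
  prob k q (λ ω → E₁ ω ∧ E₂ ω) ≡ prob k q E₁ * prob k q E₂
prob-∧ zero q S {E₁} {E₂} _ _ = indicator-∧ (E₁ (λ ())) (E₂ (λ ()))
  where
  indicator-∧ : ∀ a b → (if a ∧ b then 1ℚ else 0ℚ) ≡ (if a then 1ℚ else 0ℚ) * (if b then 1ℚ else 0ℚ)
  indicator-∧ true  true  = refl
  indicator-∧ true  false = refl
  indicator-∧ false true  = refl
  indicator-∧ false false = refl
prob-∧ (suc k) q S {E₁} {E₂} dep₁ dep₂ = trans
  (cong₂ (mix (q zero)) (prob-∧ k (q ∘ suc) (S ∘ suc) (DependsOn-tail true dep₁) (DependsOn-tail true dep₂))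
                        (prob-∧ k (q ∘ suc) (S ∘ suc) (DependsOn-tail false dep₁) (DependsOn-tail false dep₂)))
  (mix-* (q zero) head-irrelevant)
  where
  tail-prob : Event (suc k) → Bool → ℚ
  tail-prob E b = prob k (q ∘ suc) (λ ω → E (b ∷ ω))
  head-irrelevant : tail-prob E₁ true ≡ tail-prob E₁ false ⊎ tail-prob E₂ true ≡ tail-prob E₂ false
  head-irrelevant with S zero in S₀
  ... | false = inj₁ (prob-cong k (q ∘ suc) (DependsOn-head dep₁ S₀))
  ... | true  = inj₂ (prob-cong k (q ∘ suc) (DependsOn-head dep₂ (cong not S₀)))

PairwiseDisjoint : ∀ {n k} → (Fin n → Fin k → Bool) → Set
PairwiseDisjoint S = ∀ v v′ i → S v i ≡ true → S v′ i ≡ true → v ≡ v′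

≟⇒≡ : ∀ {k} {x y : Fin k} → ⌊ x ≟ y ⌋ ≡ true → x ≡ y
≟⇒≡ {x = x} {y} _ with x ≟ y
... | yes x≡y = x≡y

fibres-disjoint : ∀ {n k l} (f : Fin k → Fin l) {h : Fin n → Fin l} → Injective _≡_ _≡_ h →
  PairwiseDisjoint (λ v i → ⌊ f i ≟ h v ⌋)
fibres-disjoint f h-injective v v′ i fᵢ≡hv fᵢ≡hv′ = h-injective (trans (sym (≟⇒≡ fᵢ≡hv)) (≟⇒≡ fᵢ≡hv′))

∏ : ∀ {n} → (Fin n → ℚ) → ℚ
∏ {zero}  f = 1ℚ
∏ {suc n} f = f zero * ∏ (f ∘ suc)

∏-cong : ∀ {n} {f g : Fin n → ℚ} → (∀ i → f i ≡ g i) → ∏ f ≡ ∏ g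
∏-cong {zero}  f≗g = refl
∏-cong {suc n} f≗g = cong₂ _*_ (f≗g zero) (∏-cong (f≗g ∘ suc))

allF-cong : ∀ {n} {P Q : Fin n → Bool} → (∀ i → P i ≡ Q i) → allF P ≡ allF Q
allF-cong {zero}  P≗Q = refl
allF-cong {suc n} P≗Q = cong₂ _∧_ (P≗Q zero) (allF-cong (P≗Q ∘ suc))

anyF-cong : ∀ {n} {P Q : Fin n → Bool} → (∀ i → P i ≡ Q i) → anyF P ≡ anyF Q
anyF-cong {zero}  P≗Q = refl
anyF-cong {suc n} P≗Q = cong₂ _∨_ (P≗Q zero) (anyF-cong (P≗Q ∘ suc))

anyF≡not-allF-not : ∀ {n} (P : Fin n → Bool) → anyF P ≡ not (allF (not ∘ P))
anyF≡not-allF-not {zero}  P = refl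
anyF≡not-allF-not {suc n} P with P zero
... | true  = refl
... | false = anyF≡not-allF-not (P ∘ suc)

prob-allF : ∀ k q {n} (E : Fin n → Event k) (S : Fin n → Fin k → Bool) →
  (∀ v → DependsOn (S v) (E v)) → PairwiseDisjoint S →
  prob k q (λ ω → allF (λ v → E v ω)) ≡ ∏ (λ v → prob k q (E v))
prob-allF k q {zero}  E S dep disjoint = prob-const k q true
prob-allF k q {suc n} E S dep disjoint = trans
  (prob-∧ k q (S zero) (dep zero) rest-dependsOn)
  (cong (prob k q (E zero) *_)
        (prob-allF k q (E ∘ suc) (S ∘ suc) (dep ∘ suc)
                   (λ v v′ i Sv Sv′ → suc-injective (disjoint (suc v) (suc v′) i Sv Sv′))))
  where
  outside-S₀ : ∀ v i → S (suc v) i ≡ true → not (S zero i) ≡ true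
  outside-S₀ v i Sᵥ with S zero i in S₀
  ... | true  = ⊥-elim (0≢1+n (disjoint zero (suc v) i S₀ Sᵥ))
  ... | false = refl
  rest-dependsOn : DependsOn (not ∘ S zero) (λ ω → allF (λ v → E (suc v) ω))
  rest-dependsOn ω ω′ agree = allF-cong λ v → dep (suc v) ω ω′ (λ i Sᵥ → agree i (outside-S₀ v i Sᵥ))

prob-anyF : ∀ k q {n} (E : Fin n → Event k) (S : Fin n → Fin k → Bool) →
  (∀ v → DependsOn (S v) (E v)) → PairwiseDisjoint S →
  prob k q (λ ω → anyF (λ v → E v ω)) ≡ 1ℚ - ∏ (λ v → prob k q (not ∘ E v))
prob-anyF k q E S dep disjoint = begin
  prob k q (λ ω → anyF (λ v → E v ω))            ≡⟨ prob-cong k q (λ ω → anyF≡not-allF-not (λ v → E v ω)) ⟩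
  prob k q (λ ω → not (allF (λ v → not (E v ω)))) ≡⟨ prob-not k q _ ⟩
  1ℚ - prob k q (λ ω → allF (λ v → not (E v ω)))  ≡⟨ cong (1ℚ -_) (prob-allF k q (λ v → not ∘ E v) S dep-not disjoint) ⟩
  1ℚ - ∏ (λ v → prob k q (not ∘ E v))             ∎
  where
  open ≡-Reasoning
  dep-not : ∀ v → DependsOn (S v) (not ∘ E v)
  dep-not v ω ω′ agree = cong not (dep v ω ω′ agree)

count-cong : ∀ {n} {P Q : Fin n → Bool} → (∀ i → P i ≡ Q i) → count P ≡ count Q
count-cong {zero}  P≗Q = refl
count-cong {suc n} P≗Q = cong₂ (λ b c → (if b then 1 else 0) +ℕ c) (P≗Q zero) (count-cong (P≗Q ∘ suc))

count-≤ : ∀ {n} (P : Fin n → Bool) → count P ≤ n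
count-≤ {zero}  P = z≤n
count-≤ {suc n} P with P zero
... | true  = s≤s (count-≤ (P ∘ suc))
... | false = m≤n⇒m≤1+n (count-≤ (P ∘ suc))

count-false : ∀ n → count {n} (λ _ → false) ≡ 0
count-false zero    = refl
count-false (suc n) = count-false n

count-true : ∀ n → count {n} (λ _ → true) ≡ n
count-true zero    = refl
count-true (suc n) = cong suc (count-true n)

count-↑ : ∀ m n (P : Fin (m +ℕ n) → Bool) →
  count P ≡ count (λ (x : Fin m) → P (x ↑ˡ n)) +ℕ count (λ (y : Fin n) → P (m ↑ʳ y))
count-↑ zero    n P = refl
count-↑ (suc m) n P = trans
  (cong ((if P zero then 1 else 0) +ℕ_) (count-↑ m n (P ∘ suc)))
  (sym (+-assoc (if P zero then 1 else 0) _ _))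

≟-refl : ∀ {k} (x : Fin k) → ⌊ x ≟ x ⌋ ≡ true
≟-refl x = trans (isYes≗does (x ≟ x)) (dec-true (x ≟ x) refl)

≟-suc : ∀ {k} (x y : Fin k) → ⌊ Fin.suc x ≟ suc y ⌋ ≡ ⌊ x ≟ y ⌋
≟-suc x y = ⌊⌋-map′ _ _ (x ≟ y)

≟-↑ˡ : ∀ {m} n (x u : Fin m) → ⌊ x ↑ˡ n ≟ u ↑ˡ n ⌋ ≡ ⌊ x ≟ u ⌋
≟-↑ˡ n x u with x ≟ u
... | yes refl = ≟-refl (x ↑ˡ n)
... | no x≢u with x ↑ˡ n ≟ u ↑ˡ n
...   | yes x↑≡u↑ = ⊥-elim (x≢u (↑ˡ-injective n x u x↑≡u↑))
...   | no _      = refl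

count-≟ : ∀ {m} (u : Fin m) (f : Fin m → Bool) → count (λ x → ⌊ x ≟ u ⌋ ∧ f x) ≡ (if f u then 1 else 0)
count-≟ {suc m} zero    f = trans (cong ((if f zero then 1 else 0) +ℕ_) (count-false m)) (+-identityʳ _)
count-≟ {suc m} (suc u) f = trans
  (count-cong (λ x → cong (_∧ f (suc x)) (≟-suc x u)))
  (count-≟ u (f ∘ suc))

∏-if-power : ∀ {n} (P : Fin n → Bool) x → ∏ (λ i → if P i then x else 1ℚ) ≡ x ^ℚ count P
∏-if-power {zero}  P x = refl
∏-if-power {suc n} P x with P zero
... | true  = cong (x *_) (∏-if-power (P ∘ suc) x)
... | false = trans (*-identityˡ _) (∏-if-power (P ∘ suc) x)

∏-if-powerᶜ : ∀ {n} (P : Fin n → Bool) x → ∏ (λ i → if P i then 1ℚ else x) ≡ x ^ℚ (n ∸ count P)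
∏-if-powerᶜ {zero}  P x = refl
∏-if-powerᶜ {suc n} P x with P zero
... | true  = trans (*-identityˡ _) (∏-if-powerᶜ (P ∘ suc) x)
... | false = trans (cong (x *_) (∏-if-powerᶜ (P ∘ suc) x))
                    (cong (x ^ℚ_) (sym (+-∸-assoc 1 (count-≤ (P ∘ suc)))))

inU-↑ˡ : ∀ m n (u : Fin m) → inU {m} {n} (u ↑ˡ n) ≡ true
inU-↑ˡ (suc m) n zero    = refl
inU-↑ˡ (suc m) n (suc u) = inU-↑ˡ m n u

inU-↑ʳ : ∀ m n (v : Fin n) → inU {m} {n} (m ↑ʳ v) ≡ false
inU-↑ʳ zero    n v = refl
inU-↑ʳ (suc m) n v = inU-↑ʳ m n v

module CompleteBipartite (m n : ℕ) (B : Fin (m +ℕ n) → Bool) where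

  K-↑ˡ-↑ˡ : ∀ u x → K m n (u ↑ˡ n) (x ↑ˡ n) ≡ false
  K-↑ˡ-↑ˡ u x rewrite inU-↑ˡ m n u | inU-↑ˡ m n x = refl

  K-↑ˡ-↑ʳ : ∀ u y → K m n (u ↑ˡ n) (m ↑ʳ y) ≡ true
  K-↑ˡ-↑ʳ u y rewrite inU-↑ˡ m n u | inU-↑ʳ m n y = refl

  degree-↑ˡ : ∀ u → degree (K m n) (u ↑ˡ n) ≡ n
  degree-↑ˡ u = trans (count-↑ m n _)
    (cong₂ _+ℕ_ (trans (count-cong (K-↑ˡ-↑ˡ u)) (count-false m))
                (trans (count-cong (K-↑ˡ-↑ʳ u)) (count-true n)))

  closedNbhdBlue-↑ˡ : ∀ u → B (u ↑ˡ n) ≡ true → closedNbhdBlue (K m n) B (u ↑ˡ n) ≡ suc (blueV m n B)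
  closedNbhdBlue-↑ˡ u Bu = trans (count-↑ m n _) (cong₂ _+ℕ_ blue-in-U blue-in-V)
    where
    blue-in-U : count (λ x → (⌊ x ↑ˡ n ≟ u ↑ˡ n ⌋ ∨ K m n (u ↑ˡ n) (x ↑ˡ n)) ∧ B (x ↑ˡ n)) ≡ 1
    blue-in-U = begin
      count (λ x → (⌊ x ↑ˡ n ≟ u ↑ˡ n ⌋ ∨ K m n (u ↑ˡ n) (x ↑ˡ n)) ∧ B (x ↑ˡ n))
        ≡⟨ count-cong (λ x → cong (_∧ B (x ↑ˡ n))
             (trans (cong₂ _∨_ (≟-↑ˡ n x u) (K-↑ˡ-↑ˡ u x)) (∨-identityʳ _))) ⟩
      count (λ x → ⌊ x ≟ u ⌋ ∧ B (x ↑ˡ n))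
        ≡⟨ count-≟ u (λ x → B (x ↑ˡ n)) ⟩
      (if B (u ↑ˡ n) then 1 else 0)
        ≡⟨ cong (λ b → if b then 1 else 0) Bu ⟩
      1 ∎
      where open ≡-Reasoning
    blue-in-V : count (λ y → (⌊ m ↑ʳ y ≟ u ↑ˡ n ⌋ ∨ K m n (u ↑ˡ n) (m ↑ʳ y)) ∧ B (m ↑ʳ y)) ≡ blueV m n B
    blue-in-V = count-cong λ y → cong (_∧ B (m ↑ʳ y))
      (trans (cong (⌊ m ↑ʳ y ≟ u ↑ˡ n ⌋ ∨_) (K-↑ˡ-↑ʳ u y)) (∨-zeroʳ _))

  private
    N : ℕ
    N = m +ℕ n

  coins : ℕ
  coins = N *ℕ N

  coinProb : Fin coins → ℚ
  coinProb = attemptProb (K m n) B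

  coin : Fin m → Fin n → Fin coins
  coin u v = combine {N} {N} (u ↑ˡ n) (m ↑ʳ v)

  sourceIs targetIs : Fin N → Fin coins → Bool
  sourceIs x i = ⌊ proj₁ (remQuot {N} N i) ≟ x ⌋
  targetIs y i = ⌊ proj₂ (remQuot {N} N i) ≟ y ⌋

  sourceIs-coin : ∀ u v → sourceIs (u ↑ˡ n) (coin u v) ≡ true
  sourceIs-coin u v = trans (cong (λ r → ⌊ proj₁ r ≟ u ↑ˡ n ⌋) (remQuot-combine (u ↑ˡ n) (m ↑ʳ v)))
                            (≟-refl (u ↑ˡ n))

  targetIs-coin : ∀ u v → targetIs (m ↑ʳ v) (coin u v) ≡ true
  targetIs-coin u v = trans (cong (λ r → ⌊ proj₂ r ≟ m ↑ʳ v ⌋) (remQuot-combine (u ↑ˡ n) (m ↑ʳ v)))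
                            (≟-refl (m ↑ʳ v))

  coinProb-combine : ∀ x y → coinProb (combine x y) ≡
    (if B x ∧ not (B y) ∧ K m n x y then forceProb (K m n) B x else 0ℚ)
  coinProb-combine x y = cong (λ r → if B (proj₁ r) ∧ not (B (proj₂ r)) ∧ K m n (proj₁ r) (proj₂ r)
                                      then forceProb (K m n) B (proj₁ r) else 0ℚ)
                              (remQuot-combine x y)

  forcingProb : ℚ
  forcingProb = suc (blueV m n B) ÷ℕ n

  coinProb-coin : ∀ u v → B (u ↑ˡ n) ≡ true → B (m ↑ʳ v) ≡ false → coinProb (coin u v) ≡ forcingProb
  coinProb-coin u v Bu Bv = trans (coinProb-combine (u ↑ˡ n) (m ↑ʳ v)) forcing
    where
    forcing : (if B (u ↑ˡ n) ∧ not (B (m ↑ʳ v)) ∧ K m n (u ↑ˡ n) (m ↑ʳ v)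
               then forceProb (K m n) B (u ↑ˡ n) else 0ℚ) ≡ forcingProb
    forcing rewrite Bu | Bv | K-↑ˡ-↑ʳ u v = cong₂ _÷ℕ_ (closedNbhdBlue-↑ˡ u Bu) (degree-↑ˡ u)

  forcedFrom : Fin n → Fin m → Event coins
  forcedFrom v u ω = B (u ↑ˡ n) ∧ ω (coin u v)

  forced : Fin n → Event coins
  forced v ω = if B (m ↑ʳ v) then true else anyF (λ u → forcedFrom v u ω)

  prob-not-forcedFrom : ∀ v u → B (m ↑ʳ v) ≡ false →
    prob coins coinProb (not ∘ forcedFrom v u) ≡ (if B (u ↑ˡ n) then 1ℚ - forcingProb else 1ℚ)
  prob-not-forcedFrom v u Bv with B (u ↑ˡ n) in Bu
  ... | true  = trans (prob-not coins coinProb (λ ω → ω (coin u v)))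
                      (cong (1ℚ -_) (trans (prob-coordinate coins coinProb (coin u v)) (coinProb-coin u v Bu Bv)))
  ... | false = prob-const coins coinProb true

  prob-forced : ∀ v →
    prob coins coinProb (forced v) ≡ (if B (m ↑ʳ v) then 1ℚ else 1ℚ - (1ℚ - forcingProb) ^ℚ blueU m n B)
  prob-forced v with B (m ↑ʳ v) in Bv
  ... | true  = prob-const coins coinProb true
  ... | false = trans
    (prob-anyF coins coinProb (forcedFrom v) (λ u → sourceIs (u ↑ˡ n))
       (λ u → DependsOn-coordinate (coin u v) (B (u ↑ˡ n) ∧_) (sourceIs-coin u v))
       (fibres-disjoint _ (λ {u} {u′} → ↑ˡ-injective n u u′)))
    (cong (1ℚ -_) (trans (∏-cong (λ u → prob-not-forcedFrom v u Bv)) (∏-if-power (λ u → B (u ↑ˡ n)) (1ℚ - forcingProb))))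

  forced-dependsOn : ∀ v → DependsOn (targetIs (m ↑ʳ v)) (forced v)
  forced-dependsOn v ω ω′ agree = cong (if B (m ↑ʳ v) then true else_)
    (anyF-cong λ u → cong (B (u ↑ˡ n) ∧_) (agree (coin u v) (targetIs-coin u v)))

lemma4p14 : (m n : ℕ) (B : Fin (m +ℕ n) → Bool) →
    P[U→V] m n B
    ≡ (1ℚ - (1ℚ - (suc (blueV m n B) ÷ℕ n)) ^ℚ blueU m n B) ^ℚ (n ∸ blueV m n B)
lemma4p14 m n B = begin
  P[U→V] m n B
    ≡⟨ prob-allF coins coinProb forced (λ v → targetIs (m ↑ʳ v))
                 forced-dependsOn (fibres-disjoint _ (λ {v} {v′} → ↑ʳ-injective m v v′)) ⟩
  ∏ (λ v → prob coins coinProb (forced v))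
    ≡⟨ ∏-cong prob-forced ⟩
  ∏ (λ v → if B (m ↑ʳ v) then 1ℚ else 1ℚ - (1ℚ - forcingProb) ^ℚ blueU m n B)
    ≡⟨ ∏-if-powerᶜ (λ v → B (m ↑ʳ v)) _ ⟩
  (1ℚ - (1ℚ - forcingProb) ^ℚ blueU m n B) ^ℚ (n ∸ blueV m n B) ∎
  where
  open ≡-Reasoning
  open CompleteBipartite m n B
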